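{- The pole $\perp\!\!\!\perp$ is consistent: for every closed term $t$ there is a stack $\pi$ such that $t\ast\pi\notin\perp\!\!\!\perp$.
   Context: Fix pairwise disjoint countably infinite sets of $\lambda$-variables ($x,y,\dots$), stack variables ($\alpha,\beta,\dots$), term variables ($a,b,\dots$), and countable sets of labels $l$ and constructors $C$. Values, terms, stacks, processes: $v,w::=x\mid\lambda x\,t\mid C[v]\mid\{l_i=v_i\}_{i\in I}$; $t,u::=a\mid v\mid t\,u\mid\mu\alpha\,t\mid p\mid v.l\mid\mathrm{case}_v[C_i[x_i]\to t_i]_{i\in I}\mid\delta_{v,w}$; $\pi::=\alpha\mid v.\pi\mid[t]\pi$; $p::=t\ast\pi$; $I$ finite; $\lambda x$, $\mu\alpha$ and the $x_i$ in case branches are binders, term variables are never bound. A term is closed if it has no free variable of any kind. Substitutions map $\lambda$-variables to values, stack variables to stacks, term variables to terms (capture-avoiding). $\succ$ is the smallest relation on processes with: $t\,u\ast\pi\succ u\ast[t]\pi$; $v\ast[t]\pi\succ t\ast v.\pi$; $\lambda x\,t\ast v.\pi\succ t[x:=v]\ast\pi$; $\mu\alpha\,t\ast\pi\succ t[\alpha:=\pi]\ast\pi$; $p\ast\pi\succ p$; $\{l_i=v_i\}_{i\in I}.l_k\ast\pi\succ v_k\ast\pi$ ($k\in I$); $\mathrm{case}_{C_k[v]}[C_i[x_i]\to t_i]_{i\in I}\ast\pi\succ t_k[x_k:=v]\ast\pi$ ($k\in I$). A process is final if it is $v\ast\alpha$ with $v$ a value and $\alpha$ a stack variable; for a relation $R$,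 $p\Downarrow_R$ means $p\,R^*\,q$ with $q$ final. For $i\in\mathbb N$, inductively: $\rightsquigarrow_i=\succ\cup\{(\delta_{v,w}\ast\pi,v\ast\pi)\mid\exists j<i,\ v\not\equiv_jw\}$; $t\equiv_iu$ iff for all $j\le i$, stacks $\pi$, substitutions $\sigma$: $t\sigma\ast\pi\Downarrow_{\rightsquigarrow_j}\Leftrightarrow u\sigma\ast\pi\Downarrow_{\rightsquigarrow_j}$; $\not\equiv_i$ is its negation. $\rightsquigarrow=\bigcup_i\rightsquigarrow_i$. The pole is $\perp\!\!\!\perp=\{p\mid p\Downarrow_{\rightsquigarrow}\}$. -}

module Defs where

open import Data.Nat using (ℕ; zero; suc)
open import Data.List using (List; []; _∷_)
open import Data.Product using (Σ; ∃; ∃-syntax; _×_; _,_)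
open import Data.Sum using (_⊎_)
open import Data.Empty using (⊥)
open import Data.Unit using (⊤)
open import Function using (id)
open import Relation.Nullary using (¬_)
open import Relation.Binary.PropositionalEquality using (_≡_)
open import Data.List.Membership.Propositional using (_∈_)
open import Relation.Binary.Construct.Closure.ReflexiveTransitive using (Star)

-- Syntax.  λ-variables and stack variables are de Bruijn indices
-- (λ x and case-branch variables bind λ-index 0; μ α binds stack-index 0).
-- Term variables are never bound, named by ℕ.
-- Finite index sets I are represented by lists.

Label : Set
Label = ℕ

Constr : Set
Constr = ℕ

mutual
  data Val : Set where
    var : ℕ → Val
    lam : Term → Val
    con : Constr → Val → Val
    rec : List (Label × Val) → Val

  data Term : Set where
    tvar  : ℕ → Term
    val   : Val → Term
    app   : Term → Term → Term
    mu    : Term → Term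
    proc  : Proc → Term
    proj  : Val → Label → Term
    case  : Val → List (Constr × Term) → Term
    delta : Val → Val → Term

  data Stack : Set where
    svar  : ℕ → Stack
    push  : Val → Stack → Stack
    frame : Term → Stack → Stack

  data Proc : Set where
    _∗_ : Term → Stack → Proc

infix 4 _∗_

ext : (ℕ → ℕ) → ℕ → ℕ
ext f zero = zero
ext f (suc n) = suc (f n)

mutual
  renV : (ℕ → ℕ) → (ℕ → ℕ) → Val → Val
  renV f g (var x) = var (f x)
  renV f g (lam t) = lam (renT (ext f) g t)
  renV f g (con c v) = con c (renV f g v)
  renV f g (rec rs) = rec (renRs f g rs)

  renRs : (ℕ → ℕ) → (ℕ → ℕ) → List (Label × Val) → List (Label × Val)
  renRs f g [] = []
  renRs f g ((l , v) ∷ rs) = (l , renV f g v) ∷ renRs f g rs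

  renBs : (ℕ → ℕ) → (ℕ → ℕ) → List (Constr × Term) → List (Constr × Term)
  renBs f g [] = []
  renBs f g ((c , t) ∷ bs) = (c , renT (ext f) g t) ∷ renBs f g bs

  renT : (ℕ → ℕ) → (ℕ → ℕ) → Term → Term
  renT f g (tvar a) = tvar a
  renT f g (val v) = val (renV f g v)
  renT f g (app t u) = app (renT f g t) (renT f g u)
  renT f g (mu t) = mu (renT f (ext g) t)
  renT f g (proc p) = proc (renP f g p)
  renT f g (proj v l) = proj (renV f g v) l
  renT f g (case v bs) = case (renV f g v) (renBs f g bs)
  renT f g (delta v w) = delta (renV f g v) (renV f g w)

  renS : (ℕ → ℕ) → (ℕ → ℕ) → Stack → Stack
  renS f g (svar α) = svar (g α)
  renS f g (push v π) = push (renV f g v) (renS f g π)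
  renS f g (frame t π) = frame (renT f g t) (renS f g π)

  renP : (ℕ → ℕ) → (ℕ → ℕ) → Proc → Proc
  renP f g (t ∗ π) = renT f g t ∗ renS f g π

record Subst : Set where
  field
    sλ : ℕ → Val
    sα : ℕ → Stack
    sτ : ℕ → Term
open Subst public

liftλ : Subst → Subst
sλ (liftλ σ) zero = var zero
sλ (liftλ σ) (suc n) = renV suc id (sλ σ n)
sα (liftλ σ) n = renS suc id (sα σ n)
sτ (liftλ σ) n = renT suc id (sτ σ n)

liftα : Subst → Subst
sλ (liftα σ) n = renV id suc (sλ σ n)
sα (liftα σ) zero = svar zero
sα (liftα σ) (suc n) = renS id suc (sα σ n)
sτ (liftα σ) n = renT id suc (sτ σ n)

mutual
  subV : Subst → Val → Val
  subV σ (var x) = sλ σ x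
  subV σ (lam t) = lam (subT (liftλ σ) t)
  subV σ (con c v) = con c (subV σ v)
  subV σ (rec rs) = rec (subRs σ rs)

  subRs : Subst → List (Label × Val) → List (Label × Val)
  subRs σ [] = []
  subRs σ ((l , v) ∷ rs) = (l , subV σ v) ∷ subRs σ rs

  subBs : Subst → List (Constr × Term) → List (Constr × Term)
  subBs σ [] = []
  subBs σ ((c , t) ∷ bs) = (c , subT (liftλ σ) t) ∷ subBs σ bs

  subT : Subst → Term → Term
  subT σ (tvar a) = sτ σ a
  subT σ (val v) = val (subV σ v)
  subT σ (app t u) = app (subT σ t) (subT σ u)
  subT σ (mu t) = mu (subT (liftα σ) t)
  subT σ (proc p) = proc (subP σ p)
  subT σ (proj v l) = proj (subV σ v) l
  subT σ (case v bs) = case (subV σ v) (subBs σ bs)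
  subT σ (delta v w) = delta (subV σ v) (subV σ w)

  subS : Subst → Stack → Stack
  subS σ (svar α) = sα σ α
  subS σ (push v π) = push (subV σ v) (subS σ π)
  subS σ (frame t π) = frame (subT σ t) (subS σ π)

  subP : Subst → Proc → Proc
  subP σ (t ∗ π) = subT σ t ∗ subS σ π

[x≔_] : Val → Subst
sλ [x≔ v ] zero = v
sλ [x≔ v ] (suc n) = var n
sα [x≔ v ] n = svar n
sτ [x≔ v ] n = tvar n

[α≔_] : Stack → Subst
sλ [α≔ π ] n = var n
sα [α≔ π ] zero = π
sα [α≔ π ] (suc n) = svar n
sτ [α≔ π ] n = tvar n

open import Data.Nat using (_<_)

mutual
  ScopeV : ℕ → ℕ → Val → Set
  ScopeV dl da (var x) = x < dl
  ScopeV dl da (lam t) = ScopeT (suc dl) da t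
  ScopeV dl da (con c v) = ScopeV dl da v
  ScopeV dl da (rec rs) = ScopeRs dl da rs

  ScopeRs : ℕ → ℕ → List (Label × Val) → Set
  ScopeRs dl da [] = ⊤
  ScopeRs dl da ((l , v) ∷ rs) = ScopeV dl da v × ScopeRs dl da rs

  ScopeBs : ℕ → ℕ → List (Constr × Term) → Set
  ScopeBs dl da [] = ⊤
  ScopeBs dl da ((c , t) ∷ bs) = ScopeT (suc dl) da t × ScopeBs dl da bs

  ScopeT : ℕ → ℕ → Term → Set
  ScopeT dl da (tvar a) = ⊥
  ScopeT dl da (val v) = ScopeV dl da v
  ScopeT dl da (app t u) = ScopeT dl da t × ScopeT dl da u
  ScopeT dl da (mu t) = ScopeT dl (suc da) t
  ScopeT dl da (proc p) = ScopeP dl da p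
  ScopeT dl da (proj v l) = ScopeV dl da v
  ScopeT dl da (case v bs) = ScopeV dl da v × ScopeBs dl da bs
  ScopeT dl da (delta v w) = ScopeV dl da v × ScopeV dl da w

  ScopeS : ℕ → ℕ → Stack → Set
  ScopeS dl da (svar α) = α < da
  ScopeS dl da (push v π) = ScopeV dl da v × ScopeS dl da π
  ScopeS dl da (frame t π) = ScopeT dl da t × ScopeS dl da π

  ScopeP : ℕ → ℕ → Proc → Set
  ScopeP dl da (t ∗ π) = ScopeT dl da t × ScopeS dl da π

ClosedTerm : Term → Set
ClosedTerm t = ScopeT 0 0 t

-- Reduction.  Step D is ≻ together with the δ-rule for pairs in D.

data Step (D : Val → Val → Set) : Proc → Proc → Set where
  s-app   : ∀ t u π → Step D (app t u ∗ π) (u ∗ frame t π)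
  s-arg   : ∀ v t π → Step D (val v ∗ frame t π) (t ∗ push v π)
  s-beta  : ∀ t v π → Step D (val (lam t) ∗ push v π) (subT [x≔ v ] t ∗ π)
  s-mu    : ∀ t π → Step D (mu t ∗ π) (subT [α≔ π ] t ∗ π)
  s-proc  : ∀ p π → Step D (proc p ∗ π) p
  s-proj  : ∀ rs l v π → (l , v) ∈ rs → Step D (proj (rec rs) l ∗ π) (val v ∗ π)
  s-case  : ∀ c v bs t π → (c , t) ∈ bs →
            Step D (case (con c v) bs ∗ π) (subT [x≔ v ] t ∗ π)
  s-delta : ∀ v w π → D v w → Step D (delta v w ∗ π) (val v ∗ π)

_≻_ : Proc → Proc → Set
_≻_ = Step (λ _ _ → ⊥)

Final : Proc → Set
Final p = ∃[ v ] ∃[ α ] (p ≡ (val v ∗ svar α))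

Converges : (Proc → Proc → Set) → Proc → Set
Converges R p = ∃[ q ] (Star R p q × Final q)

-- the condition in the definition of ≡_j, for a fixed level j
-- (with D the δ-side condition of ⇝_j)
EqAt : (Val → Val → Set) → Term → Term → Set
EqAt D t u = (π : Stack) (σ : Subst) →
  (Converges (Step D) (subT σ t ∗ π) → Converges (Step D) (subT σ u ∗ π)) ×
  (Converges (Step D) (subT σ u ∗ π) → Converges (Step D) (subT σ t ∗ π))

-- DeltaOK i v w  ⇔  ∃ j < i. v ≢_j w   (unfolded recursively)
-- Equiv i t u    ⇔  t ≡_i u, i.e. EqAt at every level j ≤ i (unfolded)
mutual
  DeltaOK : ℕ → Val → Val → Set
  DeltaOK zero v w = ⊥
  DeltaOK (suc i) v w = DeltaOK i v w ⊎ ¬ Equiv i (val v) (val w)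

  Equiv : ℕ → Term → Term → Set
  Equiv zero t u = EqAt (DeltaOK zero) t u
  Equiv (suc i) t u = Equiv i t u × EqAt (DeltaOK (suc i)) t u

_⇝[_]_ : Proc → ℕ → Proc → Set
p ⇝[ i ] q = Step (DeltaOK i) p q

_⇝_ : Proc → Proc → Set
p ⇝ q = ∃[ i ] (p ⇝[ i ] q)

Pole : Proc → Set
Pole p = Converges _⇝_ p

-- Run t against the stack [λx.Ω]α. Since t is closed, the only free stack
-- variable is α, and it lies behind the frame [λx.Ω]. Every reduction step,
-- whatever δ-rule is in force, preserves the property that free stack
-- variables only occur behind such frames, so a final process v ∗ α is never
-- reached before the frame is consumed; consuming it applies λx.Ω to a value,
-- after which the process loops in Ω forever.
module Submission where

open import Defs
open import Data.Product using (∃-syntax; _×_; _,_)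
open import Relation.Nullary using (¬_)
open import Data.Nat using (ℕ; zero; suc; _<_; s≤s; z≤n)
open import Data.List using (List; []; _∷_)
open import Data.Sum using (_⊎_; inj₁; inj₂)
open import Data.Unit using (⊤; tt)
open import Function using (id)
open import Relation.Binary.PropositionalEquality using (_≡_; refl)
open import Data.List.Relation.Unary.Any using (here; there)
open import Data.List.Membership.Propositional using (_∈_)
open import Relation.Binary.Construct.Closure.ReflexiveTransitive using (Star; ε; _◅_)

ω : Val
ω = lam (app (val (var 0)) (val (var 0)))

Ω : Term
Ω = app (val ω) (val ω)

λΩ : Term
λΩ = val (lam Ω)

-- Sealed d e: every free stack variable of e is below d, or lies behind a
-- frame [λΩ] (whose continuation is never inspected).
mutual
  SealedV : ℕ → Val → Set
  SealedV d (var x) = ⊤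
  SealedV d (lam t) = SealedT d t
  SealedV d (con c v) = SealedV d v
  SealedV d (rec rs) = SealedRs d rs

  SealedRs : ℕ → List (Label × Val) → Set
  SealedRs d [] = ⊤
  SealedRs d ((l , v) ∷ rs) = SealedV d v × SealedRs d rs

  SealedBs : ℕ → List (Constr × Term) → Set
  SealedBs d [] = ⊤
  SealedBs d ((c , t) ∷ bs) = SealedT d t × SealedBs d bs

  SealedT : ℕ → Term → Set
  SealedT d (tvar a) = ⊤
  SealedT d (val v) = SealedV d v
  SealedT d (app t u) = SealedT d t × SealedT d u
  SealedT d (mu t) = SealedT (suc d) t
  SealedT d (proc p) = SealedP d p
  SealedT d (proj v l) = SealedV d v
  SealedT d (case v bs) = SealedV d v × SealedBs d bs
  SealedT d (delta v w) = SealedV d v × SealedV d w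

  SealedS : ℕ → Stack → Set
  SealedS d (svar α) = α < d
  SealedS d (push v π) = SealedV d v × SealedS d π
  SealedS d (frame t π) = t ≡ λΩ ⊎ (SealedT d t × SealedS d π)

  SealedP : ℕ → Proc → Set
  SealedP d (t ∗ π) = SealedT d t × SealedS d π

mutual
  scope⇒sealedV : ∀ {dl d} v → ScopeV dl d v → SealedV d v
  scope⇒sealedV (var x) _ = tt
  scope⇒sealedV (lam t) s = scope⇒sealedT t s
  scope⇒sealedV (con c v) s = scope⇒sealedV v s
  scope⇒sealedV (rec rs) s = scope⇒sealedRs rs s

  scope⇒sealedRs : ∀ {dl d} rs → ScopeRs dl d rs → SealedRs d rs
  scope⇒sealedRs [] _ = tt
  scope⇒sealedRs ((l , v) ∷ rs) (s , s′) = scope⇒sealedV v s , scope⇒sealedRs rs s′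

  scope⇒sealedBs : ∀ {dl d} bs → ScopeBs dl d bs → SealedBs d bs
  scope⇒sealedBs [] _ = tt
  scope⇒sealedBs ((c , t) ∷ bs) (s , s′) = scope⇒sealedT t s , scope⇒sealedBs bs s′

  scope⇒sealedT : ∀ {dl d} t → ScopeT dl d t → SealedT d t
  scope⇒sealedT (tvar a) ()
  scope⇒sealedT (val v) s = scope⇒sealedV v s
  scope⇒sealedT (app t u) (s , s′) = scope⇒sealedT t s , scope⇒sealedT u s′
  scope⇒sealedT (mu t) s = scope⇒sealedT t s
  scope⇒sealedT (proc p) s = scope⇒sealedP p s
  scope⇒sealedT (proj v l) s = scope⇒sealedV v s
  scope⇒sealedT (case v bs) (s , s′) = scope⇒sealedV v s , scope⇒sealedBs bs s′
  scope⇒sealedT (delta v w) (s , s′) = scope⇒sealedV v s , scope⇒sealedV w s′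

  scope⇒sealedS : ∀ {dl d} π → ScopeS dl d π → SealedS d π
  scope⇒sealedS (svar α) s = s
  scope⇒sealedS (push v π) (s , s′) = scope⇒sealedV v s , scope⇒sealedS π s′
  scope⇒sealedS (frame t π) (s , s′) = inj₂ (scope⇒sealedT t s , scope⇒sealedS π s′)

  scope⇒sealedP : ∀ {dl d} p → ScopeP dl d p → SealedP d p
  scope⇒sealedP (t ∗ π) (s , s′) = scope⇒sealedT t s , scope⇒sealedS π s′

record MapsBelow (g : ℕ → ℕ) (d d′ : ℕ) : Set where
  field maps-below : ∀ {α} → α < d → g α < d′
open MapsBelow

id-mapsBelow : ∀ {d} → MapsBelow id d d
maps-below id-mapsBelow α<d = α<d

suc-mapsBelow : ∀ {d} → MapsBelow suc d (suc d)
maps-below suc-mapsBelow = s≤s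

ext-mapsBelow : ∀ {g d d′} → MapsBelow g d d′ → MapsBelow (ext g) (suc d) (suc d′)
maps-below (ext-mapsBelow m) {zero} _ = s≤s z≤n
maps-below (ext-mapsBelow m) {suc α} (s≤s α<d) = s≤s (maps-below m α<d)

mutual
  sealed-renV : ∀ f {g d d′} → MapsBelow g d d′ → ∀ v → SealedV d v → SealedV d′ (renV f g v)
  sealed-renV f m (var x) _ = tt
  sealed-renV f m (lam t) h = sealed-renT (ext f) m t h
  sealed-renV f m (con c v) h = sealed-renV f m v h
  sealed-renV f m (rec rs) h = sealed-renRs f m rs h

  sealed-renRs : ∀ f {g d d′} → MapsBelow g d d′ → ∀ rs → SealedRs d rs → SealedRs d′ (renRs f g rs)
  sealed-renRs f m [] _ = tt
  sealed-renRs f m ((l , v) ∷ rs) (h , h′) = sealed-renV f m v h , sealed-renRs f m rs h′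

  sealed-renBs : ∀ f {g d d′} → MapsBelow g d d′ → ∀ bs → SealedBs d bs → SealedBs d′ (renBs f g bs)
  sealed-renBs f m [] _ = tt
  sealed-renBs f m ((c , t) ∷ bs) (h , h′) = sealed-renT (ext f) m t h , sealed-renBs f m bs h′

  sealed-renT : ∀ f {g d d′} → MapsBelow g d d′ → ∀ t → SealedT d t → SealedT d′ (renT f g t)
  sealed-renT f m (tvar a) _ = tt
  sealed-renT f m (val v) h = sealed-renV f m v h
  sealed-renT f m (app t u) (h , h′) = sealed-renT f m t h , sealed-renT f m u h′
  sealed-renT f m (mu t) h = sealed-renT f (ext-mapsBelow m) t h
  sealed-renT f m (proc p) h = sealed-renP f m p h
  sealed-renT f m (proj v l) h = sealed-renV f m v h
  sealed-renT f m (case v bs) (h , h′) = sealed-renV f m v h , sealed-renBs f m bs h′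
  sealed-renT f m (delta v w) (h , h′) = sealed-renV f m v h , sealed-renV f m w h′

  sealed-renS : ∀ f {g d d′} → MapsBelow g d d′ → ∀ π → SealedS d π → SealedS d′ (renS f g π)
  sealed-renS f m (svar α) α<d = maps-below m α<d
  sealed-renS f m (push v π) (h , h′) = sealed-renV f m v h , sealed-renS f m π h′
  sealed-renS f m (frame .λΩ π) (inj₁ refl) = inj₁ refl
  sealed-renS f m (frame t π) (inj₂ (h , h′)) = inj₂ (sealed-renT f m t h , sealed-renS f m π h′)

  sealed-renP : ∀ f {g d d′} → MapsBelow g d d′ → ∀ p → SealedP d p → SealedP d′ (renP f g p)
  sealed-renP f m (t ∗ π) (h , h′) = sealed-renT f m t h , sealed-renS f m π h′

record SealedSubst (σ : Subst) (d d′ : ℕ) : Set where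
  field
    sealedλ : ∀ x → SealedV d′ (sλ σ x)
    sealedα : ∀ {α} → α < d → SealedS d′ (sα σ α)
    sealedτ : ∀ a → SealedT d′ (sτ σ a)
open SealedSubst

liftλ-sealed : ∀ {σ d d′} → SealedSubst σ d d′ → SealedSubst (liftλ σ) d d′
sealedλ (liftλ-sealed s) zero = tt
sealedλ (liftλ-sealed {σ} s) (suc x) = sealed-renV suc id-mapsBelow (sλ σ x) (sealedλ s x)
sealedα (liftλ-sealed {σ} s) {α} α<d = sealed-renS suc id-mapsBelow (sα σ α) (sealedα s α<d)
sealedτ (liftλ-sealed {σ} s) a = sealed-renT suc id-mapsBelow (sτ σ a) (sealedτ s a)

liftα-sealed : ∀ {σ d d′} → SealedSubst σ d d′ → SealedSubst (liftα σ) (suc d) (suc d′)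
sealedλ (liftα-sealed {σ} s) x = sealed-renV id suc-mapsBelow (sλ σ x) (sealedλ s x)
sealedα (liftα-sealed s) {zero} _ = s≤s z≤n
sealedα (liftα-sealed {σ} s) {suc α} (s≤s α<d) = sealed-renS id suc-mapsBelow (sα σ α) (sealedα s α<d)
sealedτ (liftα-sealed {σ} s) a = sealed-renT id suc-mapsBelow (sτ σ a) (sealedτ s a)

mutual
  sealed-subV : ∀ {σ d d′} → SealedSubst σ d d′ → ∀ v → SealedV d v → SealedV d′ (subV σ v)
  sealed-subV s (var x) _ = sealedλ s x
  sealed-subV s (lam t) h = sealed-subT (liftλ-sealed s) t h
  sealed-subV s (con c v) h = sealed-subV s v h
  sealed-subV s (rec rs) h = sealed-subRs s rs h

  sealed-subRs : ∀ {σ d d′} → SealedSubst σ d d′ → ∀ rs → SealedRs d rs → SealedRs d′ (subRs σ rs)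
  sealed-subRs s [] _ = tt
  sealed-subRs s ((l , v) ∷ rs) (h , h′) = sealed-subV s v h , sealed-subRs s rs h′

  sealed-subBs : ∀ {σ d d′} → SealedSubst σ d d′ → ∀ bs → SealedBs d bs → SealedBs d′ (subBs σ bs)
  sealed-subBs s [] _ = tt
  sealed-subBs s ((c , t) ∷ bs) (h , h′) = sealed-subT (liftλ-sealed s) t h , sealed-subBs s bs h′

  sealed-subT : ∀ {σ d d′} → SealedSubst σ d d′ → ∀ t → SealedT d t → SealedT d′ (subT σ t)
  sealed-subT s (tvar a) _ = sealedτ s a
  sealed-subT s (val v) h = sealed-subV s v h
  sealed-subT s (app t u) (h , h′) = sealed-subT s t h , sealed-subT s u h′
  sealed-subT s (mu t) h = sealed-subT (liftα-sealed s) t h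
  sealed-subT s (proc p) h = sealed-subP s p h
  sealed-subT s (proj v l) h = sealed-subV s v h
  sealed-subT s (case v bs) (h , h′) = sealed-subV s v h , sealed-subBs s bs h′
  sealed-subT s (delta v w) (h , h′) = sealed-subV s v h , sealed-subV s w h′

  sealed-subS : ∀ {σ d d′} → SealedSubst σ d d′ → ∀ π → SealedS d π → SealedS d′ (subS σ π)
  sealed-subS s (svar α) α<d = sealedα s α<d
  sealed-subS s (push v π) (h , h′) = sealed-subV s v h , sealed-subS s π h′
  sealed-subS s (frame .λΩ π) (inj₁ refl) = inj₁ refl
  sealed-subS s (frame t π) (inj₂ (h , h′)) = inj₂ (sealed-subT s t h , sealed-subS s π h′)

  sealed-subP : ∀ {σ d d′} → SealedSubst σ d d′ → ∀ p → SealedP d p → SealedP d′ (subP σ p)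
  sealed-subP s (t ∗ π) (h , h′) = sealed-subT s t h , sealed-subS s π h′

[x≔]-sealed : ∀ {v} → SealedV 0 v → SealedSubst [x≔ v ] 0 0
sealedλ ([x≔]-sealed h) zero = h
sealedλ ([x≔]-sealed h) (suc x) = tt
sealedα ([x≔]-sealed h) ()
sealedτ ([x≔]-sealed h) a = tt

[α≔]-sealed : ∀ {π} → SealedS 0 π → SealedSubst [α≔ π ] 1 0
sealedλ ([α≔]-sealed h) x = tt
sealedα ([α≔]-sealed h) {zero} _ = h
sealedα ([α≔]-sealed h) {suc α} (s≤s ())
sealedτ ([α≔]-sealed h) a = tt

sealed-∈Rs : ∀ {d l v} rs → (l , v) ∈ rs → SealedRs d rs → SealedV d v
sealed-∈Rs (_ ∷ rs) (here refl) (h , _) = h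
sealed-∈Rs (_ ∷ rs) (there l∈rs) (_ , h) = sealed-∈Rs rs l∈rs h

sealed-∈Bs : ∀ {d c t} bs → (c , t) ∈ bs → SealedBs d bs → SealedT d t
sealed-∈Bs (_ ∷ bs) (here refl) (h , _) = h
sealed-∈Bs (_ ∷ bs) (there c∈bs) (_ , h) = sealed-∈Bs bs c∈bs h

data Doomed : Proc → Set where
  sealed     : ∀ {p} → SealedP 0 p → Doomed p
  enter-λΩ   : ∀ v π → Doomed (λΩ ∗ push v π)
  Ω-loop     : ∀ π → Doomed (Ω ∗ π)
  ω-frame    : ∀ π → Doomed (val ω ∗ frame (val ω) π)
  ω-argument : ∀ π → Doomed (val ω ∗ push ω π)

Doomed-step : ∀ {D p q} → Step D p q → Doomed p → Doomed q
Doomed-step (s-app t u π) (sealed ((ht , hu) , hπ)) = sealed (hu , inj₂ (ht , hπ))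
Doomed-step (s-arg v .λΩ π) (sealed (_ , inj₁ refl)) = enter-λΩ v π
Doomed-step (s-arg v t π) (sealed (hv , inj₂ (ht , hπ))) = sealed (ht , hv , hπ)
Doomed-step (s-beta t v π) (sealed (ht , hv , hπ)) = sealed (sealed-subT ([x≔]-sealed hv) t ht , hπ)
Doomed-step (s-mu t π) (sealed (ht , hπ)) = sealed (sealed-subT ([α≔]-sealed hπ) t ht , hπ)
Doomed-step (s-proc p π) (sealed (hp , _)) = sealed hp
Doomed-step (s-proj rs l v π l∈rs) (sealed (hrs , hπ)) = sealed (sealed-∈Rs rs l∈rs hrs , hπ)
Doomed-step (s-case c v bs t π c∈bs) (sealed ((hv , hbs) , hπ)) =
  sealed (sealed-subT ([x≔]-sealed hv) t (sealed-∈Bs bs c∈bs hbs) , hπ)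
Doomed-step (s-delta v w π _) (sealed ((hv , _) , hπ)) = sealed (hv , hπ)
Doomed-step (s-beta _ _ π) (enter-λΩ v π) = Ω-loop π
Doomed-step (s-app _ _ π) (Ω-loop π) = ω-frame π
Doomed-step (s-arg _ _ π) (ω-frame π) = ω-argument π
Doomed-step (s-beta _ _ π) (ω-argument π) = Ω-loop π

Doomed-⇝* : ∀ {p q} → Star _⇝_ p q → Doomed p → Doomed q
Doomed-⇝* ε d = d
Doomed-⇝* ((_ , step) ◅ steps) d = Doomed-⇝* steps (Doomed-step step d)

Doomed⇒¬Final : ∀ {p} → Doomed p → ¬ Final p
Doomed⇒¬Final (sealed (_ , ())) (v , α , refl)

theorem5 : (t : Term) → ClosedTerm t → ∃[ π ] (¬ Pole (t ∗ π))
theorem5 t closed = frame λΩ (svar 0) , λ (q , steps , final) →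
  Doomed⇒¬Final (Doomed-⇝* steps start) final
  where
  start : Doomed (t ∗ frame λΩ (svar 0))
  start = sealed (scope⇒sealedT t closed , inj₁ refl)
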